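{- Let $G=A_5$, let $x\in G$ be an involution and $\alpha=\sigma_x$ (so $\alpha(y)=xyx$). Then for every two-element subset $S\subseteq G$ that is a generalized Cayley subset with respect to $\alpha$, the graph $\mathrm{GC}(G,S,\alpha)$ is vertex-transitive.
   Context: For $\alpha\in\mathrm{Aut}(G)$ with $\alpha^2=1$, $S\subseteq G$ is a generalized Cayley subset w.r.t. $\alpha$ if $\alpha(g)g^{ -1}\notin S$ for all $g\in G$ and $\alpha(g^{ -1})h\in S$ implies $\alpha(h^{ -1})g\in S$; then $\mathrm{GC}(G,S,\alpha)$ is the simple undirected graph with vertex set $G$ and $\{g,h\}$ an edge iff $\alpha(g^{ -1})h\in S$. -}

module Defs where

open import Data.Bool using (Bool; true; false; T; _∧_; not)
open import Data.Nat using (ℕ; zero; suc; _+_)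
open import Data.Fin using (Fin; zero; suc; _<?_)
open import Data.Fin.Properties using (_≟_)
open import Data.Vec using (Vec; lookup; tabulate)
open import Data.List using (List; []; _∷_; allFin; map; foldr; filter; length; concatMap)
open import Data.Product using (Σ; Σ-syntax; _×_; _,_; proj₁; ∃-syntax)
open import Data.Sum using (_⊎_)
open import Relation.Nullary using (¬_; does)
open import Relation.Binary.PropositionalEquality using (_≡_)
open import Function.Definitions using (Bijective)

-- Permutations of {0,…,4}, in one-line notation: p i = lookup p i.

Perm : Set
Perm = Vec (Fin 5) 5

_·_ : Perm → Perm → Perm
p · q = tabulate (λ i → lookup p (lookup q i))
infixl 7 _·_

idP : Perm
idP = tabulate (λ i → i)

preimage : Perm → Fin 5 → Fin 5
preimage p i = go (allFin 5)
  where
  go : List (Fin 5) → Fin 5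
  go [] = zero
  go (j ∷ js) with does (lookup p j ≟ i)
  ... | true  = j
  ... | false = go js

_⁻¹ : Perm → Perm
p ⁻¹ = tabulate (preimage p)
infix 8 _⁻¹

pairs : List (Fin 5 × Fin 5)
pairs = concatMap (λ i → map (λ j → (i , j)) (filter (λ j → i <? j) (allFin 5))) (allFin 5)

-- p is injective (hence a bijection of Fin 5)
isPermB : Perm → Bool
isPermB p = foldr (λ ij b → not (does (lookup p (proj₁ ij) ≟ lookup p (Data.Product.proj₂ ij))) ∧ b) true pairs

inversions : Perm → ℕ
inversions p = length (filter (λ ij → lookup p (Data.Product.proj₂ ij) <? lookup p (proj₁ ij)) pairs)

evenB : ℕ → Bool
evenB zero = true
evenB (suc n) = not (evenB n)

isA5 : Perm → Bool
isA5 p = isPermB p ∧ evenB (inversions p)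

A5 : Set
A5 = Σ[ p ∈ Perm ] T (isA5 p)

elt : A5 → Perm
elt = proj₁

σ : Perm → Perm → Perm
σ x y = x · y · x

IsInvolution : A5 → Set
IsInvolution x = (elt x · elt x ≡ idP) × ¬ (elt x ≡ idP)

-- Two-element subsets S = {s₁ , s₂} of G (s₁ ≠ s₂), and membership

_∈₂_ : Perm → A5 × A5 → Set
y ∈₂ (s₁ , s₂) = (y ≡ elt s₁) ⊎ (y ≡ elt s₂)

IsGCSubset : (Perm → Perm) → A5 × A5 → Set
IsGCSubset α S =
  ((g : A5) → ¬ ((α (elt g) · (elt g) ⁻¹) ∈₂ S)) ×
  ((g h : A5) → (α ((elt g) ⁻¹) · elt h) ∈₂ S → (α ((elt h) ⁻¹) · elt g) ∈₂ S)

GCAdj : (Perm → Perm) → A5 × A5 → A5 → A5 → Set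
GCAdj α S g h = (α ((elt g) ⁻¹) · elt h) ∈₂ S

IsAutomorphism : {V : Set} → (V → V → Set) → (V → V) → Set
IsAutomorphism {V} Adj f =
  Bijective _≡_ _≡_ f ×
  ((u v : V) → (Adj u v → Adj (f u) (f v)) × (Adj (f u) (f v) → Adj u v))

VertexTransitive : (V : Set) → (V → V → Set) → Set
VertexTransitive V Adj =
  (u v : V) → Σ[ f ∈ (V → V) ] (IsAutomorphism Adj f × f u ≡ v)

module Submission where

-- Let τ(s) = α(s)⁻¹. Symmetry of the graph at the identity says τ maps S into S.
-- If τ fixed some s ∈ S, then x s would have order at most 2; as all involutions of A₅
-- are conjugate, x s = g x g⁻¹ would give α(g) g⁻¹ = s ∈ S, which is excluded; so x s = 1,
-- i.e. s = x. As S has two elements, τ s₁ = s₂ follows, and the edges are the pairs {g , π g}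
-- with π(g) = α(g) s₁ = x g y, y = x s₁. Now πᶜ(g) = xᶜ g yᶜ, and y has odd order (3 or 5),
-- so no nontrivial power of π fixes a vertex. The graph is therefore a disjoint union of
-- cycles of one common length, and such a graph is vertex-transitive: a power of π moves
-- along a cycle, and exchanging two cycles position by position moves between them.

open import Defs renaming (_⁻¹ to _⁻¹ₚ)
open import Level using (0ℓ)
open import Algebra.Bundles using (Group)
open import Algebra.Structures using (IsGroup)
import Algebra.Properties.Group as GroupProperties
import Algebra.Properties.Monoid.Mult as MonoidMult
open import Data.Bool using (T)
open import Data.Bool.Properties using (T-irrelevant)
open import Data.Nat using (ℕ; zero; suc; _+_; _*_; _∸_; _≤_; NonZero)
open import Data.Nat.Properties using (+-comm; *-comm; ≤-total; m∸n+n≡m; m≤m*n)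
open import Data.Nat.DivMod using (_%_; _/_; m≡m%n+[m/n]*n; m%n<n)
open import Data.Fin using (Fin; toℕ; fromℕ<)
open import Data.Fin.Patterns
import Data.Fin.Properties as Fin
open import Data.Vec using (Vec; []; _∷_; lookup; tabulate)
open import Data.Vec.Properties using (lookup∘tabulate; tabulate∘lookup; tabulate-cong)
import Data.Vec.Properties as Vec
open import Data.List using (List; []; _∷_; allFin; concatMap; map; filter)
open import Data.List.Membership.Propositional using (_∈_)
open import Data.List.Membership.Propositional.Properties using (∈-allFin; ∈-map⁺; ∈-concatMap⁺; ∈-filter⁺)
open import Data.List.Relation.Unary.All as All using (all?)
open import Data.List.Relation.Unary.Any as Any using (here; any?)
open import Data.Product using (Σ; _×_; _,_; proj₁; proj₂; ∃-syntax)
import Data.Product.Properties as Product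
open import Data.Sum using (_⊎_; inj₁; inj₂)
import Data.Sum as Sum
open import Data.Empty using (⊥-elim)
open import Function.Base using (_∘_)
open import Function.Bundles using (_⇔_; Equivalence; mk⇔)
open import Function.Definitions using (Bijective)
open import Function.Consequences using (inverseᵇ⇒bijective)
open import Function.Consequences.Propositional using (strictlyInverseˡ⇒inverseˡ; strictlyInverseʳ⇒inverseʳ)
import Function.Endo.Propositional as Endo
open import Relation.Nullary using (¬_; Dec; yes; no)
open import Relation.Nullary.Decidable using (T?; map′; from-yes; _×-dec_; _→-dec_; ¬?)
open import Relation.Binary.Definitions using (DecidableEquality)
open import Relation.Binary.PropositionalEquality

automorphism-resp : {V : Set} {Adj Adj′ : V → V → Set} → (∀ u v → Adj u v ⇔ Adj′ u v) →
  {f : V → V} → IsAutomorphism Adj f → IsAutomorphism Adj′ f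
automorphism-resp equiv {f} (bij , preserves) = bij , λ u v →
  (λ a → to (equiv (f u) (f v)) (proj₁ (preserves u v) (from (equiv u v) a))) ,
  (λ a → to (equiv u v) (proj₂ (preserves u v) (from (equiv (f u) (f v)) a)))
  where
  open Equivalence

vertexTransitive-resp : {V : Set} {Adj Adj′ : V → V → Set} → (∀ u v → Adj u v ⇔ Adj′ u v) →
  VertexTransitive V Adj → VertexTransitive V Adj′
vertexTransitive-resp equiv transitive u v with transitive u v
... | f , aut , fu≡v = f , automorphism-resp equiv aut , fu≡v

inverse⇒bijective : {A : Set} {f g : A → A} → (∀ y → f (g y) ≡ y) → (∀ x → g (f x) ≡ x) →
  Bijective _≡_ _≡_ f
inverse⇒bijective {f = f} fg gf = inverseᵇ⇒bijective _≡_ refl sym trans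
  (strictlyInverseˡ⇒inverseˡ f fg , strictlyInverseʳ⇒inverseʳ f gf)

CycleAdj : {V : Set} → (V → V) → V → V → Set
CycleAdj π g h = h ≡ π g ⊎ g ≡ π h

-- The setting: π is a permutation of V of period N that is semiregular, i.e. no power
-- of π other than the identity has a fixed point.
module CycleGraph {V : Set} (_≟_ : DecidableEquality V) (π : V → V)
  (N : ℕ) .{{_ : NonZero N}} (period : ∀ v → (Endo._^_ V π N) v ≡ v)
  (semiregular : ∀ c u → (Endo._^_ V π c) u ≡ u → ∀ v → (Endo._^_ V π c) v ≡ v)
  where

  open Endo V using (_^_; ^-homo)
  open ≡-Reasoning

  iterate-+ : ∀ m n v → (π ^ (m + n)) v ≡ (π ^ m) ((π ^ n) v)
  iterate-+ m n v = cong-app (^-homo π m n) v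

  iterate-comm : ∀ k v → (π ^ k) (π v) ≡ π ((π ^ k) v)
  iterate-comm k v = begin
    (π ^ k) (π v)   ≡⟨ iterate-+ k 1 v ⟨
    (π ^ (k + 1)) v ≡⟨ cong (λ m → (π ^ m) v) (+-comm k 1) ⟩
    π ((π ^ k) v)   ∎

  period-multiple : ∀ q v → (π ^ (q * N)) v ≡ v
  period-multiple zero v = refl
  period-multiple (suc q) v = begin
    (π ^ (N + q * N)) v     ≡⟨ iterate-+ N (q * N) v ⟩
    (π ^ N) ((π ^ (q * N)) v) ≡⟨ cong (π ^ N) (period-multiple q v) ⟩
    (π ^ N) v               ≡⟨ period v ⟩
    v                       ∎

  undo : ℕ → ℕ
  undo k = k * N ∸ k

  undo-+ : ∀ k → undo k + k ≡ k * N
  undo-+ k = m∸n+n≡m (m≤m*n k N)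

  undo-left : ∀ k v → (π ^ undo k) ((π ^ k) v) ≡ v
  undo-left k v = begin
    (π ^ undo k) ((π ^ k) v) ≡⟨ iterate-+ (undo k) k v ⟨
    (π ^ (undo k + k)) v     ≡⟨ cong (λ m → (π ^ m) v) (undo-+ k) ⟩
    (π ^ (k * N)) v          ≡⟨ period-multiple k v ⟩
    v                        ∎

  undo-right : ∀ k v → (π ^ k) ((π ^ undo k) v) ≡ v
  undo-right k v = begin
    (π ^ k) ((π ^ undo k) v) ≡⟨ iterate-+ k (undo k) v ⟨
    (π ^ (k + undo k)) v     ≡⟨ cong (λ m → (π ^ m) v) (+-comm k (undo k)) ⟩
    (π ^ (undo k + k)) v     ≡⟨ iterate-+ (undo k) k v ⟩
    (π ^ undo k) ((π ^ k) v) ≡⟨ undo-left k v ⟩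
    v                        ∎

  iterate-bijective : ∀ k → Bijective _≡_ _≡_ (π ^ k)
  iterate-bijective k = inverse⇒bijective (undo-right k) (undo-left k)

  realign-≤ : ∀ {j k} → j ≤ k → ∀ u v → (π ^ j) u ≡ (π ^ k) u → (π ^ j) v ≡ (π ^ k) v
  realign-≤ {j} {k} j≤k u v eq = begin
    (π ^ j) v                 ≡⟨ semiregular (k ∸ j) ((π ^ j) u) fixed ((π ^ j) v) ⟨
    (π ^ (k ∸ j)) ((π ^ j) v) ≡⟨ shift v ⟩
    (π ^ k) v                 ∎
    where
    shift : ∀ w → (π ^ (k ∸ j)) ((π ^ j) w) ≡ (π ^ k) w
    shift w = trans (sym (iterate-+ (k ∸ j) j w)) (cong (λ m → (π ^ m) w) (m∸n+n≡m j≤k))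
    fixed : (π ^ (k ∸ j)) ((π ^ j) u) ≡ (π ^ j) u
    fixed = trans (shift u) (sym eq)

  realign : ∀ j k u v → (π ^ j) u ≡ (π ^ k) u → (π ^ j) v ≡ (π ^ k) v
  realign j k u v eq with ≤-total j k
  ... | inj₁ j≤k = realign-≤ j≤k u v eq
  ... | inj₂ k≤j = sym (realign-≤ k≤j u v (sym eq))

  -- g lies on the cycle through u; decidable since it suffices to look at N steps
  Orbit : V → V → Set
  Orbit u g = ∃[ k ] (π ^ k) u ≡ g

  orbit-trans : ∀ {u g h} → Orbit u g → Orbit g h → Orbit u h
  orbit-trans {u} (j , refl) (k , refl) = k + j , iterate-+ k j u

  orbit-sym : ∀ {u g} → Orbit u g → Orbit g u
  orbit-sym (k , refl) = undo k , undo-left k _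

  orbit-π⁻ : ∀ {u g} → Orbit u (π g) → Orbit u g
  orbit-π⁻ o = orbit-trans o (orbit-sym (1 , refl))

  orbit? : ∀ u g → Dec (Orbit u g)
  orbit? u g with Fin.any? (λ (i : Fin N) → (π ^ toℕ i) u ≟ g)
  ... | yes (i , p) = yes (toℕ i , p)
  ... | no none = no λ { (k , p) → none (fromℕ< (m%n<n k N) , trans (reduce k) p) }
    where
    reduce : ∀ k → (π ^ toℕ (fromℕ< (m%n<n k N))) u ≡ (π ^ k) u
    reduce k = begin
      (π ^ toℕ (fromℕ< (m%n<n k N))) u     ≡⟨ cong (λ m → (π ^ m) u) (Fin.toℕ-fromℕ< (m%n<n k N)) ⟩
      (π ^ (k % N)) u                     ≡⟨ cong (π ^ (k % N)) (period-multiple (k / N) u) ⟨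
      (π ^ (k % N)) ((π ^ ((k / N) * N)) u) ≡⟨ iterate-+ (k % N) ((k / N) * N) u ⟨
      (π ^ (k % N + (k / N) * N)) u       ≡⟨ cong (λ m → (π ^ m) u) (m≡m%n+[m/n]*n k N) ⟨
      (π ^ k) u                           ∎

  commuting⇒automorphism : (f : V → V) → Bijective _≡_ _≡_ f → (∀ g → f (π g) ≡ π (f g)) →
    IsAutomorphism (CycleAdj π) f
  commuting⇒automorphism f bij@(injective , _) comm = bij , λ g h →
    forward g h , backward g h
    where
    forward : ∀ g h → CycleAdj π g h → CycleAdj π (f g) (f h)
    forward g h (inj₁ h≡πg) = inj₁ (trans (cong f h≡πg) (comm g))
    forward g h (inj₂ g≡πh) = inj₂ (trans (cong f g≡πh) (comm h))
    backward : ∀ g h → CycleAdj π (f g) (f h) → CycleAdj π g h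
    backward g h (inj₁ eq) = inj₁ (injective (trans eq (sym (comm g))))
    backward g h (inj₂ eq) = inj₂ (injective (trans eq (sym (comm h))))

  module Exchange (u v : V) (apart : ¬ Orbit u v) where

    data Position (g : V) : Set where
      onU       : ∀ k → (π ^ k) u ≡ g → Position g
      onV       : ∀ k → ¬ Orbit u g → (π ^ k) v ≡ g → Position g
      elsewhere : ¬ Orbit u g → ¬ Orbit v g → Position g

    position : ∀ g → Position g
    position g with orbit? u g | orbit? v g
    ... | yes (k , p) | _           = onU k p
    ... | no ¬u       | yes (k , p) = onV k ¬u p
    ... | no ¬u       | no ¬v       = elsewhere ¬u ¬v

    exchangeAt : ∀ {g} → Position g → V
    exchangeAt (onU k _)           = (π ^ k) v
    exchangeAt (onV k _ _)         = (π ^ k) u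
    exchangeAt {g} (elsewhere _ _) = g

    exchange : V → V
    exchange g = exchangeAt (position g)

    -- the defining equations; well-defined on the cycles by semiregularity
    exchange-onU : ∀ k → exchange ((π ^ k) u) ≡ (π ^ k) v
    exchange-onU k = at (position _)
      where
      at : (p : Position ((π ^ k) u)) → exchangeAt p ≡ (π ^ k) v
      at (onU j eq)        = realign j k u v eq
      at (onV _ ¬u _)      = ⊥-elim (¬u (k , refl))
      at (elsewhere ¬u _)  = ⊥-elim (¬u (k , refl))

    exchange-onV : ∀ k → exchange ((π ^ k) v) ≡ (π ^ k) u
    exchange-onV k = at (position _)
      where
      at : (p : Position ((π ^ k) v)) → exchangeAt p ≡ (π ^ k) u
      at (onU j eq)        = ⊥-elim (apart (orbit-trans (j , eq) (orbit-sym (k , refl))))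
      at (onV j _ eq)      = realign j k v u eq
      at (elsewhere _ ¬v)  = ⊥-elim (¬v (k , refl))

    exchange-elsewhere : ∀ {g} → ¬ Orbit u g → ¬ Orbit v g → exchange g ≡ g
    exchange-elsewhere {g} ¬u ¬v = at (position g)
      where
      at : (p : Position g) → exchangeAt p ≡ g
      at (onU k p)       = ⊥-elim (¬u (k , p))
      at (onV k _ p)     = ⊥-elim (¬v (k , p))
      at (elsewhere _ _) = refl

    exchange-involutive : ∀ g → exchange (exchange g) ≡ g
    exchange-involutive g = at (position g)
      where
      at : ∀ {g} → Position g → exchange (exchange g) ≡ g
      at (onU k refl)      = trans (cong exchange (exchange-onU k)) (exchange-onV k)
      at (onV k _ refl)    = trans (cong exchange (exchange-onV k)) (exchange-onU k)
      at (elsewhere ¬u ¬v) = trans (cong exchange (exchange-elsewhere ¬u ¬v)) (exchange-elsewhere ¬u ¬v)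

    exchange-comm : ∀ g → exchange (π g) ≡ π (exchange g)
    exchange-comm g = at (position g)
      where
      at : ∀ {g} → Position g → exchange (π g) ≡ π (exchange g)
      at (onU k refl)      = trans (exchange-onU (suc k)) (cong π (sym (exchange-onU k)))
      at (onV k _ refl)    = trans (exchange-onV (suc k)) (cong π (sym (exchange-onV k)))
      at (elsewhere ¬u ¬v) = trans (exchange-elsewhere (¬u ∘ orbit-π⁻) (¬v ∘ orbit-π⁻))
                                   (cong π (sym (exchange-elsewhere ¬u ¬v)))

  cycleGraph-vertexTransitive : VertexTransitive V (CycleAdj π)
  cycleGraph-vertexTransitive u v with orbit? u v
  ... | yes (k , πᵏu≡v) = π ^ k ,
        commuting⇒automorphism (π ^ k) (iterate-bijective k) (iterate-comm k) , πᵏu≡v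
  ... | no apart = exchange ,
        commuting⇒automorphism exchange
          (inverse⇒bijective exchange-involutive exchange-involutive) exchange-comm ,
        exchange-onU 0
    where open Exchange u v apart

-- The
-- structure is given as an IsGroup so that concrete groups (A₅ below) plug in
-- directly; the bundle gives the usual operator notation and fixities.
module GroupFacts {G : Set} {op : G → G → G} {e : G} {inv : G → G}
  (isGroup : IsGroup _≡_ op e inv) where

  group : Group 0ℓ 0ℓ
  group = record { isGroup = isGroup }

  open Group group public using (_∙_; ε; _⁻¹; assoc; identityˡ; identityʳ; inverseˡ; inverseʳ)
  open ≡-Reasoning

  open GroupProperties group public
    using (∙-cancelʳ; inverseʳ-unique; ε⁻¹≈ε; ⁻¹-injective; y≈x\\z;
           \\-leftDividesˡ; \\-leftDividesʳ; //-rightDividesˡ; //-rightDividesʳ)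
  open MonoidMult (Group.monoid group) using (×-homo-+; ×-homo-1; ×-assocˡ) renaming (_×_ to _⊗_)

  infixr 9 _^_
  _^_ : G → ℕ → G
  a ^ n = n ⊗ a

  ^-+ : ∀ a m n → a ^ (m + n) ≡ a ^ m ∙ a ^ n
  ^-+ a m n = ×-homo-+ a m n

  ^-* : ∀ a m n → (a ^ n) ^ m ≡ a ^ (m * n)
  ^-* a m n = ×-assocˡ a m n

  square : ∀ a → a ^ 2 ≡ a ∙ a
  square a = cong (a ∙_) (identityʳ a)

  ε^ : ∀ n → ε ^ n ≡ ε
  ε^ zero    = refl
  ε^ (suc n) = trans (identityˡ _) (ε^ n)

  ^-comm : ∀ a n → a ^ n ∙ a ≡ a ∙ a ^ n
  ^-comm a n = begin
    a ^ n ∙ a       ≡⟨ cong (a ^ n ∙_) (×-homo-1 a) ⟨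
    a ^ n ∙ a ^ 1   ≡⟨ ^-+ a n 1 ⟨
    a ^ (n + 1)     ≡⟨ cong (a ^_) (+-comm n 1) ⟩
    a ∙ a ^ n       ∎

  power-of-trivial : ∀ a m n → a ^ m ≡ ε → (a ^ n) ^ m ≡ ε
  power-of-trivial a m n aᵐ≡ε = begin
    (a ^ n) ^ m   ≡⟨ ^-* a m n ⟩
    a ^ (m * n)   ≡⟨ cong (a ^_) (*-comm m n) ⟩
    a ^ (n * m)   ≡⟨ ^-* a n m ⟨
    (a ^ m) ^ n   ≡⟨ cong (_^ n) aᵐ≡ε ⟩
    ε ^ n         ≡⟨ ε^ n ⟩
    ε             ∎

  power-of-involution : ∀ a → a ∙ a ≡ ε → ∀ n → a ^ n ∙ a ^ n ≡ ε
  power-of-involution a a²≡ε n = begin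
    a ^ n ∙ a ^ n   ≡⟨ square (a ^ n) ⟨
    (a ^ n) ^ 2     ≡⟨ power-of-trivial a 2 n (trans (square a) a²≡ε) ⟩
    ε               ∎

  odd-power-involution : ∀ z k → z ∙ z ≡ ε → z ^ (1 + 2 * k) ≡ ε → z ≡ ε
  odd-power-involution z k z²≡ε zᵐ≡ε = begin
    z                     ≡⟨ identityʳ z ⟨
    z ∙ ε                 ≡⟨ cong (z ∙_) (power-of-involution z z²≡ε k) ⟨
    z ∙ (z ^ k ∙ z ^ k)   ≡⟨ cong (z ∙_) (square (z ^ k)) ⟨
    z ∙ (z ^ k) ^ 2       ≡⟨ cong (z ∙_) (^-* z 2 k) ⟩
    z ^ (1 + 2 * k)       ≡⟨ zᵐ≡ε ⟩
    ε                     ∎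

  left-division : ∀ {a h s} → a ⁻¹ ∙ h ≡ s → h ≡ a ∙ s
  left-division {a} {h} refl = sym (\\-leftDividesˡ a h)

  left-division⁻¹ : ∀ {a h s} → h ≡ a ∙ s → a ⁻¹ ∙ h ≡ s
  left-division⁻¹ {a} {s = s} refl = \\-leftDividesʳ a s

  conjugate-square : ∀ a w → a ∙ a ≡ ε → (w ⁻¹ ∙ (a ∙ w)) ∙ (w ⁻¹ ∙ (a ∙ w)) ≡ ε
  conjugate-square a w a²≡ε = begin
    (w ⁻¹ ∙ (a ∙ w)) ∙ (w ⁻¹ ∙ (a ∙ w)) ≡⟨ assoc (w ⁻¹) (a ∙ w) _ ⟩
    w ⁻¹ ∙ ((a ∙ w) ∙ (w ⁻¹ ∙ (a ∙ w))) ≡⟨ cong (w ⁻¹ ∙_) (assoc a w _) ⟩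
    w ⁻¹ ∙ (a ∙ (w ∙ (w ⁻¹ ∙ (a ∙ w)))) ≡⟨ cong (λ t → w ⁻¹ ∙ (a ∙ t)) (\\-leftDividesˡ w (a ∙ w)) ⟩
    w ⁻¹ ∙ (a ∙ (a ∙ w))                ≡⟨ cong (w ⁻¹ ∙_) (assoc a a w) ⟨
    w ⁻¹ ∙ ((a ∙ a) ∙ w)                ≡⟨ cong (λ t → w ⁻¹ ∙ (t ∙ w)) a²≡ε ⟩
    w ⁻¹ ∙ (ε ∙ w)                      ≡⟨ cong (w ⁻¹ ∙_) (identityˡ w) ⟩
    w ⁻¹ ∙ w                            ≡⟨ inverseˡ w ⟩
    ε                                   ∎

  Conjugate : G → G → Set
  Conjugate a b = ∃[ g ] g ∙ a ≡ b ∙ g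

  conjugate-sym : ∀ {a b} → Conjugate a b → Conjugate b a
  conjugate-sym {a} {b} (g , ga≡bg) = g ⁻¹ , (begin
    g ⁻¹ ∙ b                  ≡⟨ //-rightDividesʳ g (g ⁻¹ ∙ b) ⟨
    ((g ⁻¹ ∙ b) ∙ g) ∙ g ⁻¹   ≡⟨ cong (_∙ g ⁻¹) (assoc (g ⁻¹) b g) ⟩
    (g ⁻¹ ∙ (b ∙ g)) ∙ g ⁻¹   ≡⟨ cong (λ t → (g ⁻¹ ∙ t) ∙ g ⁻¹) ga≡bg ⟨
    (g ⁻¹ ∙ (g ∙ a)) ∙ g ⁻¹   ≡⟨ cong (_∙ g ⁻¹) (\\-leftDividesʳ g a) ⟩
    a ∙ g ⁻¹                  ∎)

  conjugate-trans : ∀ {a b c} → Conjugate a b → Conjugate b c → Conjugate a c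
  conjugate-trans {a} {b} {c} (g , ga≡bg) (h , hb≡ch) = h ∙ g , (begin
    (h ∙ g) ∙ a   ≡⟨ assoc h g a ⟩
    h ∙ (g ∙ a)   ≡⟨ cong (h ∙_) ga≡bg ⟩
    h ∙ (b ∙ g)   ≡⟨ assoc h b g ⟨
    (h ∙ b) ∙ g   ≡⟨ cong (_∙ g) hb≡ch ⟩
    (c ∙ h) ∙ g   ≡⟨ assoc c h g ⟩
    c ∙ (h ∙ g)   ∎)

  IsInvolutionᴳ : G → Set
  IsInvolutionᴳ a = a ∙ a ≡ ε × ¬ a ≡ ε

  module InnerInvolution (x : G) (x²≡ε : x ∙ x ≡ ε) where

    α : G → G
    α g = (x ∙ g) ∙ x

    x⁻¹≡x : x ⁻¹ ≡ x
    x⁻¹≡x = sym (inverseʳ-unique x x x²≡ε)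

    x-cancel : ∀ a → x ∙ (x ∙ a) ≡ a
    x-cancel a = trans (sym (assoc x x a)) (trans (cong (_∙ a) x²≡ε) (identityˡ a))

    α-∙ : ∀ a b → α (a ∙ b) ≡ α a ∙ α b
    α-∙ a b = begin
      (x ∙ (a ∙ b)) ∙ x               ≡⟨ cong (_∙ x) (assoc x a b) ⟨
      ((x ∙ a) ∙ b) ∙ x               ≡⟨ assoc (x ∙ a) b x ⟩
      (x ∙ a) ∙ (b ∙ x)               ≡⟨ cong ((x ∙ a) ∙_) (x-cancel (b ∙ x)) ⟨
      (x ∙ a) ∙ (x ∙ (x ∙ (b ∙ x)))   ≡⟨ assoc (x ∙ a) x _ ⟨
      α a ∙ (x ∙ (b ∙ x))             ≡⟨ cong (α a ∙_) (assoc x b x) ⟨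
      α a ∙ α b                       ∎

    α-ε : α ε ≡ ε
    α-ε = trans (cong (_∙ x) (identityʳ x)) x²≡ε

    α-⁻¹ : ∀ a → α (a ⁻¹) ≡ (α a) ⁻¹
    α-⁻¹ a = inverseʳ-unique (α a) (α (a ⁻¹))
      (trans (sym (α-∙ a (a ⁻¹))) (trans (cong α (inverseʳ a)) α-ε))

    α-involutive : ∀ a → α (α a) ≡ a
    α-involutive a = begin
      (x ∙ ((x ∙ a) ∙ x)) ∙ x   ≡⟨ cong (_∙ x) (assoc x (x ∙ a) x) ⟨
      ((x ∙ (x ∙ a)) ∙ x) ∙ x   ≡⟨ cong (λ t → (t ∙ x) ∙ x) (x-cancel a) ⟩
      (a ∙ x) ∙ x               ≡⟨ assoc a x x ⟩
      a ∙ (x ∙ x)               ≡⟨ cong (a ∙_) x²≡ε ⟩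
      a ∙ ε                     ≡⟨ identityʳ a ⟩
      a                         ∎

module TwoElementGC {G : Set} {op : G → G → G} {e : G} {inv : G → G}
  (isGroup : IsGroup _≡_ op e inv) (_≟_ : DecidableEquality G) where

  open GroupFacts isGroup
  open ≡-Reasoning
  open Endo G using () renaming (_^_ to _^ᶠ_)

  module _ (involutions-conjugate : ∀ {a b} → IsInvolutionᴳ a → IsInvolutionᴳ b → Conjugate a b)
           (k : ℕ) (odd-order : ∀ y → ¬ y ∙ y ≡ ε → y ^ (1 + 2 * k) ≡ ε)
           (x : G) (x²≡ε : x ∙ x ≡ ε) (x≢ε : ¬ x ≡ ε)
           (s₁ s₂ : G) (s₁≢s₂ : ¬ s₁ ≡ s₂) where

    open InnerInvolution x x²≡ε

    InS : G → Set
    InS t = t ≡ s₁ ⊎ t ≡ s₂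

    Edge : G → G → Set
    Edge g h = InS (α (g ⁻¹) ∙ h)

    module _ (no-loop : ∀ g → ¬ InS (α g ∙ g ⁻¹))
             (symmetric : ∀ g h → Edge g h → Edge h g) where

      InS-resp : ∀ {a b} → a ≡ b → InS a → InS b
      InS-resp refl i = i

      -- τ s = α(s)⁻¹ ; symmetry of the graph at the identity says τ maps S to S
      τ : G → G
      τ s = (α s) ⁻¹

      τ-closed : ∀ {s} → InS s → InS (τ s)
      τ-closed {s} s∈S = InS-resp at-s (symmetric ε s (InS-resp at-ε s∈S))
        where
        at-ε : s ≡ α (ε ⁻¹) ∙ s
        at-ε = sym (trans (cong (λ t → α t ∙ s) ε⁻¹≈ε) (trans (cong (_∙ s) α-ε) (identityˡ s)))
        at-s : α (s ⁻¹) ∙ ε ≡ τ s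
        at-s = trans (identityʳ _) (α-⁻¹ s)

      τ-injective : ∀ {a b} → τ a ≡ τ b → a ≡ b
      τ-injective {a} {b} eq = begin
        a         ≡⟨ α-involutive a ⟨
        α (α a)   ≡⟨ cong α (⁻¹-injective eq) ⟩
        α (α b)   ≡⟨ α-involutive b ⟩
        b         ∎

      τ-x : τ x ≡ x
      τ-x = begin
        ((x ∙ x) ∙ x) ⁻¹   ≡⟨ cong (λ t → (t ∙ x) ⁻¹) x²≡ε ⟩
        (ε ∙ x) ⁻¹         ≡⟨ cong _⁻¹ (identityˡ x) ⟩
        x ⁻¹               ≡⟨ x⁻¹≡x ⟩
        x                  ∎

      -- the only element s of S with x s of order at most 2 is x itself:
      -- otherwise x s is an involution g x g⁻¹, and then α(g) g⁻¹ = s ∈ S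
      square⇒x : ∀ {s} → InS s → (x ∙ s) ∙ (x ∙ s) ≡ ε → s ≡ x
      square⇒x {s} s∈S sq with (x ∙ s) ≟ ε
      ... | yes xs≡ε = trans (inverseʳ-unique x s xs≡ε) x⁻¹≡x
      ... | no xs≢ε with involutions-conjugate (x²≡ε , x≢ε) (sq , xs≢ε)
      ...   | g , gx≡xsg = ⊥-elim (no-loop g (InS-resp (sym loop) s∈S))
        where
        loop : α g ∙ g ⁻¹ ≡ s
        loop = begin
          ((x ∙ g) ∙ x) ∙ g ⁻¹         ≡⟨ cong (_∙ g ⁻¹) (assoc x g x) ⟩
          (x ∙ (g ∙ x)) ∙ g ⁻¹         ≡⟨ cong (λ t → (x ∙ t) ∙ g ⁻¹) gx≡xsg ⟩
          (x ∙ ((x ∙ s) ∙ g)) ∙ g ⁻¹   ≡⟨ assoc x _ _ ⟩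
          x ∙ (((x ∙ s) ∙ g) ∙ g ⁻¹)   ≡⟨ cong (x ∙_) (//-rightDividesʳ g (x ∙ s)) ⟩
          x ∙ (x ∙ s)                  ≡⟨ x-cancel s ⟩
          s                            ∎

      τ-fixed⇒square : ∀ {s} → τ s ≡ s → (x ∙ s) ∙ (x ∙ s) ≡ ε
      τ-fixed⇒square {s} τs≡s = begin
        (x ∙ s) ∙ (x ∙ s)   ≡⟨ assoc (x ∙ s) x s ⟨
        α s ∙ s             ≡⟨ cong (α s ∙_) τs≡s ⟨
        α s ∙ τ s           ≡⟨ inverseʳ (α s) ⟩
        ε                   ∎

      -- τ exchanges the two elements of S: if τ s₁ = s₁ then s₁ = x, and either
      -- τ s₂ = s₁ = τ s₁ or again s₂ = x; both contradict s₁ ≠ s₂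
      τs₁≡s₂ : τ s₁ ≡ s₂
      τs₁≡s₂ with τ-closed (inj₁ refl)
      ... | inj₂ τs₁≡s₂ = τs₁≡s₂
      ... | inj₁ τs₁≡s₁ with τ-closed (inj₂ refl)
      ...   | inj₁ τs₂≡s₁ = ⊥-elim (s₁≢s₂ (τ-injective (trans τs₁≡s₁ (sym τs₂≡s₁))))
      ...   | inj₂ τs₂≡s₂ = ⊥-elim (s₁≢s₂ (trans (at-x (inj₁ refl) τs₁≡s₁) (sym (at-x (inj₂ refl) τs₂≡s₂))))
        where
        at-x : ∀ {s} → InS s → τ s ≡ s → s ≡ x
        at-x s∈S fixed = square⇒x s∈S (τ-fixed⇒square fixed)

      -- y = x s₁ has odd order: if it had order at most 2, s₁ = x = τ s₁ = s₂
      y : G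
      y = x ∙ s₁

      y-not-involution : ¬ y ∙ y ≡ ε
      y-not-involution y²≡ε = s₁≢s₂ (begin
        s₁     ≡⟨ s₁≡x ⟩
        x      ≡⟨ τ-x ⟨
        τ x    ≡⟨ cong τ s₁≡x ⟨
        τ s₁   ≡⟨ τs₁≡s₂ ⟩
        s₂     ∎)
        where
        s₁≡x : s₁ ≡ x
        s₁≡x = square⇒x (inj₁ refl) y²≡ε

      -- the s₁-neighbour of g; every edge is {g , π g} for some g
      π : G → G
      π g = α g ∙ s₁

      neighbour : ∀ {g h s} → α (g ⁻¹) ∙ h ≡ s → h ≡ α g ∙ s
      neighbour {g} eq = left-division (trans (cong (_∙ _) (sym (α-⁻¹ g))) eq)

      neighbour⁻¹ : ∀ {g h s} → h ≡ α g ∙ s → α (g ⁻¹) ∙ h ≡ s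
      neighbour⁻¹ {g} eq = trans (cong (_∙ _) (α-⁻¹ g)) (left-division⁻¹ eq)

      s₂-neighbour : ∀ g h → h ≡ α g ∙ s₂ → g ≡ π h
      s₂-neighbour g h refl = sym (begin
        α (α g ∙ s₂) ∙ s₁          ≡⟨ cong (_∙ s₁) (α-∙ (α g) s₂) ⟩
        (α (α g) ∙ α s₂) ∙ s₁      ≡⟨ cong (λ t → (t ∙ α s₂) ∙ s₁) (α-involutive g) ⟩
        (g ∙ α s₂) ∙ s₁            ≡⟨ cong (λ t → (g ∙ α t) ∙ s₁) τs₁≡s₂ ⟨
        (g ∙ α (τ s₁)) ∙ s₁        ≡⟨ cong (λ t → (g ∙ t) ∙ s₁) (α-⁻¹ (α s₁)) ⟩
        (g ∙ (α (α s₁)) ⁻¹) ∙ s₁   ≡⟨ cong (λ t → (g ∙ t ⁻¹) ∙ s₁) (α-involutive s₁) ⟩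
        (g ∙ s₁ ⁻¹) ∙ s₁           ≡⟨ //-rightDividesˡ s₁ g ⟩
        g                          ∎)

      edge⇒cycle : ∀ g h → Edge g h → CycleAdj π g h
      edge⇒cycle g h (inj₁ eq) = inj₁ (neighbour eq)
      edge⇒cycle g h (inj₂ eq) = inj₂ (s₂-neighbour g h (neighbour eq))

      cycle⇒edge : ∀ g h → CycleAdj π g h → Edge g h
      cycle⇒edge g h (inj₁ h≡πg) = inj₁ (neighbour⁻¹ h≡πg)
      cycle⇒edge g h (inj₂ g≡πh) = symmetric h g (inj₁ (neighbour⁻¹ g≡πh))

      π-iterate : ∀ c g → (π ^ᶠ c) g ≡ x ^ c ∙ (g ∙ y ^ c)
      π-iterate zero g = sym (trans (identityˡ _) (identityʳ g))
      π-iterate (suc c) g = begin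
        α ((π ^ᶠ c) g) ∙ s₁                     ≡⟨ cong (λ t → α t ∙ s₁) (π-iterate c g) ⟩
        ((x ∙ (X ∙ (g ∙ Y))) ∙ x) ∙ s₁          ≡⟨ assoc (x ∙ (X ∙ (g ∙ Y))) x s₁ ⟩
        (x ∙ (X ∙ (g ∙ Y))) ∙ y                 ≡⟨ cong (_∙ y) (assoc x X (g ∙ Y)) ⟨
        ((x ∙ X) ∙ (g ∙ Y)) ∙ y                 ≡⟨ assoc (x ∙ X) (g ∙ Y) y ⟩
        (x ∙ X) ∙ ((g ∙ Y) ∙ y)                 ≡⟨ cong ((x ∙ X) ∙_) (assoc g Y y) ⟩
        (x ∙ X) ∙ (g ∙ (Y ∙ y))                 ≡⟨ cong (λ t → (x ∙ X) ∙ (g ∙ t)) (^-comm y c) ⟩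
        x ^ suc c ∙ (g ∙ y ^ suc c)             ∎
        where
        X = x ^ c
        Y = y ^ c

      y-odd : y ^ (1 + 2 * k) ≡ ε
      y-odd = odd-order y y-not-involution

      period : ∀ g → (π ^ᶠ (2 * (1 + 2 * k))) g ≡ g
      period g = begin
        (π ^ᶠ (2 * m)) g             ≡⟨ π-iterate (2 * m) g ⟩
        x ^ (2 * m) ∙ (g ∙ y ^ (2 * m)) ≡⟨ cong₂ (λ a b → a ∙ (g ∙ b)) x-vanishes y-vanishes ⟩
        ε ∙ (g ∙ ε)                  ≡⟨ trans (identityˡ _) (identityʳ g) ⟩
        g                            ∎
        where
        m = 1 + 2 * k
        x-vanishes : x ^ (2 * m) ≡ ε
        x-vanishes = trans (sym (^-* x 2 m)) (trans (square (x ^ m)) (power-of-involution x x²≡ε m))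
        y-vanishes : y ^ (2 * m) ≡ ε
        y-vanishes = trans (sym (^-* y 2 m)) (trans (cong (_^ 2) y-odd) (ε^ 2))

      -- no power of π other than the identity fixes a vertex: if xᶜ w yᶜ = w then
      -- yᶜ = w⁻¹ xᶜ w has order at most 2 and odd order, so yᶜ = ε and then xᶜ = ε
      semiregular : ∀ c w → (π ^ᶠ c) w ≡ w → ∀ v → (π ^ᶠ c) v ≡ v
      semiregular c w fixed v = begin
        (π ^ᶠ c) v       ≡⟨ π-iterate c v ⟩
        X ∙ (v ∙ Y)      ≡⟨ cong₂ (λ a b → a ∙ (v ∙ b)) X≡ε Y≡ε ⟩
        ε ∙ (v ∙ ε)      ≡⟨ trans (identityˡ _) (identityʳ v) ⟩
        v                ∎
        where
        X = x ^ c
        Y = y ^ c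
        X²≡ε : X ∙ X ≡ ε
        X²≡ε = power-of-involution x x²≡ε c
        wY≡Xw : w ∙ Y ≡ X ∙ w
        wY≡Xw = trans (y≈x\\z X (w ∙ Y) w (trans (sym (π-iterate c w)) fixed))
                      (cong (_∙ w) (sym (inverseʳ-unique X X X²≡ε)))
        Y²≡ε : Y ∙ Y ≡ ε
        Y²≡ε = trans (cong₂ _∙_ Y≡conj Y≡conj) (conjugate-square X w X²≡ε)
          where Y≡conj = y≈x\\z w Y (X ∙ w) wY≡Xw
        Y≡ε : Y ≡ ε
        Y≡ε = odd-power-involution Y k Y²≡ε (power-of-trivial y (1 + 2 * k) c y-odd)
        X≡ε : X ≡ ε
        X≡ε = ∙-cancelʳ w X ε (begin
          X ∙ w   ≡⟨ wY≡Xw ⟨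
          w ∙ Y   ≡⟨ cong (w ∙_) Y≡ε ⟩
          w ∙ ε   ≡⟨ identityʳ w ⟩
          w       ≡⟨ identityˡ w ⟨
          ε ∙ w   ∎)

      gc-vertexTransitive : VertexTransitive G Edge
      gc-vertexTransitive = vertexTransitive-resp
        (λ g h → mk⇔ (cycle⇒edge g h) (edge⇒cycle g h))
        (CycleGraph.cycleGraph-vertexTransitive _≟_ π (2 * (1 + 2 * k)) period semiregular)

-- Its elements are enumerated once and for all; universal and
-- existential statements over A₅ then become decidable, and the two group-theoretic
-- properties used above are verified by evaluation.

vectors : (n : ℕ) → List (Vec (Fin 5) n)
vectors zero    = [] ∷ []
vectors (suc n) = concatMap (λ i → map (i ∷_) (vectors n)) (allFin 5)

vectors-complete : ∀ {n} (v : Vec (Fin 5) n) → v ∈ vectors n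
vectors-complete []      = here refl
vectors-complete (i ∷ v) = ∈-concatMap⁺ (λ i → map (i ∷_) (vectors _))
  (Any.map (λ { refl → ∈-map⁺ (i ∷_) (vectors-complete v) }) (∈-allFin i))

-- the 60 even permutations, listed explicitly so that the finite checks below
-- do not recompute them
A5-elements : List Perm
A5-elements =
  (0F ∷ 1F ∷ 2F ∷ 3F ∷ 4F ∷ []) ∷
  (0F ∷ 1F ∷ 3F ∷ 4F ∷ 2F ∷ []) ∷
  (0F ∷ 1F ∷ 4F ∷ 2F ∷ 3F ∷ []) ∷
  (0F ∷ 2F ∷ 1F ∷ 4F ∷ 3F ∷ []) ∷
  (0F ∷ 2F ∷ 3F ∷ 1F ∷ 4F ∷ []) ∷
  (0F ∷ 2F ∷ 4F ∷ 3F ∷ 1F ∷ []) ∷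
  (0F ∷ 3F ∷ 1F ∷ 2F ∷ 4F ∷ []) ∷
  (0F ∷ 3F ∷ 2F ∷ 4F ∷ 1F ∷ []) ∷
  (0F ∷ 3F ∷ 4F ∷ 1F ∷ 2F ∷ []) ∷
  (0F ∷ 4F ∷ 1F ∷ 3F ∷ 2F ∷ []) ∷
  (0F ∷ 4F ∷ 2F ∷ 1F ∷ 3F ∷ []) ∷
  (0F ∷ 4F ∷ 3F ∷ 2F ∷ 1F ∷ []) ∷
  (1F ∷ 0F ∷ 2F ∷ 4F ∷ 3F ∷ []) ∷
  (1F ∷ 0F ∷ 3F ∷ 2F ∷ 4F ∷ []) ∷
  (1F ∷ 0F ∷ 4F ∷ 3F ∷ 2F ∷ []) ∷
  (1F ∷ 2F ∷ 0F ∷ 3F ∷ 4F ∷ []) ∷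
  (1F ∷ 2F ∷ 3F ∷ 4F ∷ 0F ∷ []) ∷
  (1F ∷ 2F ∷ 4F ∷ 0F ∷ 3F ∷ []) ∷
  (1F ∷ 3F ∷ 0F ∷ 4F ∷ 2F ∷ []) ∷
  (1F ∷ 3F ∷ 2F ∷ 0F ∷ 4F ∷ []) ∷
  (1F ∷ 3F ∷ 4F ∷ 2F ∷ 0F ∷ []) ∷
  (1F ∷ 4F ∷ 0F ∷ 2F ∷ 3F ∷ []) ∷
  (1F ∷ 4F ∷ 2F ∷ 3F ∷ 0F ∷ []) ∷
  (1F ∷ 4F ∷ 3F ∷ 0F ∷ 2F ∷ []) ∷
  (2F ∷ 0F ∷ 1F ∷ 3F ∷ 4F ∷ []) ∷
  (2F ∷ 0F ∷ 3F ∷ 4F ∷ 1F ∷ []) ∷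
  (2F ∷ 0F ∷ 4F ∷ 1F ∷ 3F ∷ []) ∷
  (2F ∷ 1F ∷ 0F ∷ 4F ∷ 3F ∷ []) ∷
  (2F ∷ 1F ∷ 3F ∷ 0F ∷ 4F ∷ []) ∷
  (2F ∷ 1F ∷ 4F ∷ 3F ∷ 0F ∷ []) ∷
  (2F ∷ 3F ∷ 0F ∷ 1F ∷ 4F ∷ []) ∷
  (2F ∷ 3F ∷ 1F ∷ 4F ∷ 0F ∷ []) ∷
  (2F ∷ 3F ∷ 4F ∷ 0F ∷ 1F ∷ []) ∷
  (2F ∷ 4F ∷ 0F ∷ 3F ∷ 1F ∷ []) ∷
  (2F ∷ 4F ∷ 1F ∷ 0F ∷ 3F ∷ []) ∷
  (2F ∷ 4F ∷ 3F ∷ 1F ∷ 0F ∷ []) ∷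
  (3F ∷ 0F ∷ 1F ∷ 4F ∷ 2F ∷ []) ∷
  (3F ∷ 0F ∷ 2F ∷ 1F ∷ 4F ∷ []) ∷
  (3F ∷ 0F ∷ 4F ∷ 2F ∷ 1F ∷ []) ∷
  (3F ∷ 1F ∷ 0F ∷ 2F ∷ 4F ∷ []) ∷
  (3F ∷ 1F ∷ 2F ∷ 4F ∷ 0F ∷ []) ∷
  (3F ∷ 1F ∷ 4F ∷ 0F ∷ 2F ∷ []) ∷
  (3F ∷ 2F ∷ 0F ∷ 4F ∷ 1F ∷ []) ∷
  (3F ∷ 2F ∷ 1F ∷ 0F ∷ 4F ∷ []) ∷
  (3F ∷ 2F ∷ 4F ∷ 1F ∷ 0F ∷ []) ∷
  (3F ∷ 4F ∷ 0F ∷ 1F ∷ 2F ∷ []) ∷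
  (3F ∷ 4F ∷ 1F ∷ 2F ∷ 0F ∷ []) ∷
  (3F ∷ 4F ∷ 2F ∷ 0F ∷ 1F ∷ []) ∷
  (4F ∷ 0F ∷ 1F ∷ 2F ∷ 3F ∷ []) ∷
  (4F ∷ 0F ∷ 2F ∷ 3F ∷ 1F ∷ []) ∷
  (4F ∷ 0F ∷ 3F ∷ 1F ∷ 2F ∷ []) ∷
  (4F ∷ 1F ∷ 0F ∷ 3F ∷ 2F ∷ []) ∷
  (4F ∷ 1F ∷ 2F ∷ 0F ∷ 3F ∷ []) ∷
  (4F ∷ 1F ∷ 3F ∷ 2F ∷ 0F ∷ []) ∷
  (4F ∷ 2F ∷ 0F ∷ 1F ∷ 3F ∷ []) ∷
  (4F ∷ 2F ∷ 1F ∷ 3F ∷ 0F ∷ []) ∷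
  (4F ∷ 2F ∷ 3F ∷ 0F ∷ 1F ∷ []) ∷
  (4F ∷ 3F ∷ 0F ∷ 2F ∷ 1F ∷ []) ∷
  (4F ∷ 3F ∷ 1F ∷ 0F ∷ 2F ∷ []) ∷
  (4F ∷ 3F ∷ 2F ∷ 1F ∷ 0F ∷ []) ∷
  []

A5-elements-correct : filter (T? ∘ isA5) (vectors 5) ≡ A5-elements
A5-elements-correct = refl

A5-complete : ∀ p → T (isA5 p) → p ∈ A5-elements
A5-complete p t = subst (p ∈_) A5-elements-correct (∈-filter⁺ (T? ∘ isA5) (vectors-complete p) t)

module _ {P : A5 → Set} (P? : ∀ a → Dec (P a)) where

  private
    every-proof : ∀ p → Dec ((t : T (isA5 p)) → P (p , t))
    every-proof p with T? (isA5 p)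
    ... | yes t = map′ (λ h t′ → subst (λ t → P (p , t)) (T-irrelevant t t′) h) (λ f → f t) (P? (p , t))
    ... | no ¬t = yes (λ t → ⊥-elim (¬t t))

    some-proof : ∀ p → Dec (Σ (T (isA5 p)) λ t → P (p , t))
    some-proof p with T? (isA5 p)
    ... | yes t = map′ (t ,_) (λ (t′ , h) → subst (λ t → P (p , t)) (T-irrelevant t′ t) h) (P? (p , t))
    ... | no ¬t = no (λ (t , _) → ¬t t)

  ∀A5? : Dec (∀ a → P a)
  ∀A5? = map′ (λ all (p , t) → All.lookup all (A5-complete p t) t)
              (λ f → All.tabulate (λ {p} _ t → f (p , t)))
              (all? every-proof A5-elements)

  ∃A5? : Dec (∃[ a ] P a)
  ∃A5? = map′ (λ some → witness (Any.satisfied some))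
              (λ ((p , t) , h) → Any.map (λ { refl → t , h }) (A5-complete p t))
              (any? some-proof A5-elements)
    where
    witness : (∃[ p ] Σ (T (isA5 p)) λ t → P (p , t)) → ∃[ a ] P a
    witness (p , t , h) = (p , t) , h

·-assoc : ∀ p q r → (p · q) · r ≡ p · (q · r)
·-assoc p q r = trans (tabulate-cong (λ i → lookup∘tabulate (λ j → lookup p (lookup q j)) (lookup r i)))
                      (sym (tabulate-cong (λ i → cong (lookup p) (lookup∘tabulate (λ j → lookup q (lookup r j)) i))))

·-identityˡ : ∀ p → idP · p ≡ p
·-identityˡ p = trans (tabulate-cong (λ i → lookup∘tabulate (λ j → j) (lookup p i))) (tabulate∘lookup p)

·-identityʳ : ∀ p → p · idP ≡ p
·-identityʳ p = trans (tabulate-cong (λ i → cong (lookup p) (lookup∘tabulate (λ j → j) i))) (tabulate∘lookup p)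

infix 4 _≟ₚ_ _≟_
_≟ₚ_ : DecidableEquality Perm
_≟ₚ_ = Vec.≡-dec Fin._≟_

elt-injective : ∀ {a b : A5} → elt a ≡ elt b → a ≡ b
elt-injective {p , t} {.p , t′} refl = cong (p ,_) (T-irrelevant t t′)

_≟_ : DecidableEquality A5
_≟_ = Product.≡-dec _≟ₚ_ (λ t t′ → yes (T-irrelevant t t′))

-- A₅ is closed under composition and inversion, checked element by element. The
-- checks are abstract so that their (large) computed proofs are never unfolded later.
abstract
  ·-closed : ∀ (a b : A5) → T (isA5 (elt a · elt b))
  ·-closed = from-yes (∀A5? λ a → ∀A5? λ b → T? (isA5 (elt a · elt b)))

  ⁻¹-closed : ∀ (a : A5) → T (isA5 (elt a ⁻¹ₚ)) × elt a ⁻¹ₚ · elt a ≡ idP × elt a · elt a ⁻¹ₚ ≡ idP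
  ⁻¹-closed = from-yes (∀A5? λ a →
    T? (isA5 (elt a ⁻¹ₚ)) ×-dec (elt a ⁻¹ₚ · elt a ≟ₚ idP) ×-dec (elt a · elt a ⁻¹ₚ ≟ₚ idP))

infixl 7 _∙_
infix 8 _⁻¹

_∙_ : A5 → A5 → A5
a ∙ b = elt a · elt b , ·-closed a b

ε : A5
ε = idP , _

_⁻¹ : A5 → A5
a ⁻¹ = elt a ⁻¹ₚ , proj₁ (⁻¹-closed a)

A5-isGroup : IsGroup _≡_ _∙_ ε _⁻¹
A5-isGroup = record
  { isMonoid = record
    { isSemigroup = record
      { isMagma = record { isEquivalence = isEquivalence ; ∙-cong = cong₂ _∙_ }
      ; assoc   = λ a b c → elt-injective (·-assoc (elt a) (elt b) (elt c))
      }
    ; identity = (λ a → elt-injective (·-identityˡ (elt a))) , (λ a → elt-injective (·-identityʳ (elt a)))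
    }
  ; inverse = (λ a → elt-injective (proj₁ (proj₂ (⁻¹-closed a))))
            , (λ a → elt-injective (proj₂ (proj₂ (⁻¹-closed a))))
  ; ⁻¹-cong = cong _⁻¹
  }

open GroupFacts A5-isGroup using (_^_; Conjugate; IsInvolutionᴳ; conjugate-sym; conjugate-trans)

x₀ : A5
x₀ = (1F ∷ 0F ∷ 3F ∷ 2F ∷ 4F ∷ []) , _

abstract
  -- the elements of A₅ that are not involutions have order 1, 3 or 5
  odd-order : ∀ y → ¬ y ∙ y ≡ ε → y ^ 15 ≡ ε
  odd-order = from-yes (∀A5? λ y → ¬? (y ∙ y ≟ ε) →-dec (y ^ 15 ≟ ε))

  conjugate-to-x₀ : ∀ z → z ∙ z ≡ ε → ¬ z ≡ ε → Conjugate x₀ z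
  conjugate-to-x₀ = from-yes (∀A5? λ z → (z ∙ z ≟ ε) →-dec ¬? (z ≟ ε) →-dec ∃A5? λ g → g ∙ x₀ ≟ z ∙ g)

involutions-conjugate : ∀ {a b} → IsInvolutionᴳ a → IsInvolutionᴳ b → Conjugate a b
involutions-conjugate (a²≡ε , a≢ε) (b²≡ε , b≢ε) =
  conjugate-trans (conjugate-sym (conjugate-to-x₀ _ a²≡ε a≢ε)) (conjugate-to-x₀ _ b²≡ε b≢ε)

membership : ∀ (t s₁ s₂ : A5) → (t ≡ s₁ ⊎ t ≡ s₂) ⇔ (elt t ∈₂ (s₁ , s₂))
membership t s₁ s₂ = mk⇔ (Sum.map (cong elt) (cong elt)) (Sum.map elt-injective elt-injective)

corollary5p2 : (x : A5) → IsInvolution x →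
    (s₁ s₂ : A5) → ¬ (s₁ ≡ s₂) →
    IsGCSubset (σ (elt x)) (s₁ , s₂) →
    VertexTransitive A5 (GCAdj (σ (elt x)) (s₁ , s₂))
corollary5p2 x (x²≡id , x≢id) s₁ s₂ s₁≢s₂ (no-loop , symmetric) =
  vertexTransitive-resp (λ g h → membership _ s₁ s₂)
    (TwoElementGC.gc-vertexTransitive A5-isGroup _≟_ involutions-conjugate 7 odd-order
      x (elt-injective x²≡id) (x≢id ∘ cong elt) s₁ s₂ s₁≢s₂ no-loop′ symmetric′)
  where
  open Equivalence
  InS : A5 → Set
  InS t = t ≡ s₁ ⊎ t ≡ s₂
  no-loop′ : ∀ g → ¬ InS ((x ∙ g) ∙ x ∙ g ⁻¹)
  no-loop′ g = no-loop g ∘ to (membership _ s₁ s₂)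
  symmetric′ : ∀ g h → InS ((x ∙ g ⁻¹) ∙ x ∙ h) → InS ((x ∙ h ⁻¹) ∙ x ∙ g)
  symmetric′ g h = from (membership _ s₁ s₂) ∘ symmetric g h ∘ to (membership _ s₁ s₂)
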